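{- Let $\mu$ be the morphism on $\{0,1\}^*$ with $\mu(0)=01$, $\mu(1)=10$, and let $\mathbf{TM}_0$ be its fixed point beginning with $0$. Then: (i) $\mathbf{TM}_0$ is not everywhere Abelian $3$-repetitive; (ii) neither of the infinite words $0\mathbf{TM}_0$ and $1\mathbf{TM}_0$ has a prefix that is an Abelian $3$-power; (iii) every infinite binary overlap-free word is everywhere Abelian $2$-repetitive but not everywhere Abelian $3$-repetitive.
   Context: Two finite words are Abelian equivalent if each letter occurs the same number of times in both. For $k\ge 2$, a nonempty word $w$ is an Abelian $k$-power if $w=u_1\cdots u_k$ with the $u_i$ pairwise Abelian equivalent. An infinite word $\mathbf{z}$ is everywhere Abelian $k$-repetitive if there exists an integer $n\ge1$ such that every factor (subword) of $\mathbf{z}$ of length $n$ has a prefix that is an Abelian $k$-power. A binary word is overlap-free if it contains no factor of the form $axaxa$ with $a\in\{0,1\}$ a letter and $x$ a (possibly empty) word. -}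

module Defs where

open import Data.Bool using (Bool; true; false)
open import Data.Bool.Properties using (_≟_)
open import Data.Nat using (ℕ; zero; suc; _+_; _*_; _≤_; s≤s; z≤n)
open import Data.List using (List; []; _∷_; _++_; length; map; concatMap; concat; filter; upTo; lookup)
open import Data.Vec using (Vec; toList)
import Data.Vec as Vec
open import Data.Fin using (Fin; fromℕ<)
open import Data.Product using (Σ; ∃; _×_; _,_)
open import Relation.Binary.PropositionalEquality using (_≡_; _≢_; sym)
open import Relation.Nullary using (¬_)

-- Letters: 0 = false, 1 = true.
Letter : Set
Letter = Bool

FinWord : Set
FinWord = List Letter

InfWord : Set
InfWord = ℕ → Letter

μ₁ : Letter → FinWord
μ₁ false = false ∷ true ∷ []
μ₁ true  = true ∷ false ∷ []

μ : FinWord → FinWord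
μ = concatMap μ₁

μIter : ℕ → FinWord
μIter zero    = false ∷ []
μIter (suc n) = μ (μIter n)

μIter-len : ∀ n → suc n Data.Nat.≤ length (μIter (suc n))
μIter-len = lemma
  where
  open import Data.Nat.Properties
  open import Data.List.Properties using (length-++)
  μ-len : ∀ w → length (μ w) ≡ 2 * length w
  μ-len [] = Relation.Binary.PropositionalEquality.refl
  μ-len (false ∷ w) rewrite μ-len w | +-identityʳ (length w) | +-suc (length w) (length w) = Relation.Binary.PropositionalEquality.refl
  μ-len (true ∷ w) rewrite μ-len w | +-identityʳ (length w) | +-suc (length w) (length w) = Relation.Binary.PropositionalEquality.refl
  step : ∀ m L → suc m ≤ L → suc (suc m) ≤ 2 * L
  step m L p rewrite +-identityʳ L = ≤-trans (s≤s p) (≤-trans (≤-reflexive (sym (+-comm L 1))) (+-monoʳ-≤ L (≤-trans (s≤s z≤n) p)))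
  lemma : ∀ n → suc n Data.Nat.≤ length (μIter (suc n))
  lemma zero = s≤s z≤n
  lemma (suc n) rewrite μ-len (μIter (suc n)) = step n (length (μIter (suc n))) (lemma n)

-- TM₀ : the fixed point of μ beginning with 0, i.e. the limit of μ^n(0);
-- its n-th letter is the n-th letter of μ^(n+1)(0).
TM₀ : InfWord
TM₀ n = lookup (μIter (suc n)) (fromℕ< (μIter-len n))

cons : Letter → InfWord → InfWord
cons a z zero    = a
cons a z (suc n) = z n

factor : InfWord → ℕ → ℕ → FinWord
factor z i n = map (λ j → z (i + j)) (upTo n)

count : Letter → FinWord → ℕ
count a w = length (filter (a ≟_) w)

AbelianEquiv : FinWord → FinWord → Set
AbelianEquiv u v = ∀ a → count a u ≡ count a v

AbelianPower : ℕ → FinWord → Set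
AbelianPower k w =
  (w ≢ []) × Σ (Vec FinWord k) (λ us →
    (concat (toList us) ≡ w) × (∀ i j → AbelianEquiv (Vec.lookup us i) (Vec.lookup us j)))

HasAbelianPowerPrefix : ℕ → FinWord → Set
HasAbelianPowerPrefix k w = Σ FinWord (λ p → Σ FinWord (λ s → (w ≡ p ++ s) × AbelianPower k p))

InfHasAbelianPowerPrefix : ℕ → InfWord → Set
InfHasAbelianPowerPrefix k z = ∃ λ m → AbelianPower k (factor z 0 m)

EverywhereAbelianRepetitive : ℕ → InfWord → Set
EverywhereAbelianRepetitive k z =
  ∃ λ n → (1 ≤ n) × (∀ i → HasAbelianPowerPrefix k (factor z i n))

OverlapFree : InfWord → Set
OverlapFree z = ∀ (i : ℕ) (a : Letter) (x : FinWord) →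
  factor z i (3 + 2 * length x) ≢ (a ∷ x) ++ (a ∷ x) ++ (a ∷ [])

module Submission where

-- The key combinatorial fact (module LetterThenBlock) is that a letter c followed by a
-- Thue–Morse block μᵏ(b) of length 2ᵏ has no Abelian-cube prefix of length ≤ 2ᵏ + 1: every
-- aligned pair of the block contains c exactly once, which fixes the number of c's in the
-- prefixes of c·μᵏ(b) and is incompatible with the proportions K, 2K, 3K of an Abelian cube.
-- Hence a word containing blocks of every order at positive positions (HasBlocks) is not
-- everywhere Abelian 3-repetitive, and a·TM₀ has no Abelian-cube prefix at all.
--
-- TM₀ has blocks of every order because it is the fixed point of μ (TM-fixed) and μ turns a
-- block of order k into one of order k+1 (block-image).  An overlap-free word has them
-- because it desubstitutes: from some positive position on, it is the μ-image of another
-- overlap-free word (desubstitute), so induction on the order applies.  Desubstitution and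
-- the Abelian-square property rest on three facts about binary words of length 5, 7 and 10,
-- verified by an exhaustive search whose answers carry their own proofs.

open import Defs
open import Data.Bool using (Bool; true; false; not; T; _∧_; _xor_)
open import Data.Bool.Properties using (_≟_; T-∧; not-distribʳ-xor; xor-identityʳ)
open import Data.Empty using (⊥-elim)
open import Data.Fin using (fromℕ<) renaming (zero to #0; suc to #s)
open import Data.List
  using (List; []; _∷_; _++_; length; map; filter; upTo; applyUpTo; lookup; foldr; take; drop;
         concatMap; inits; tails)
open import Data.List.Properties
  using (∷-injective; ∷-injectiveˡ; ∷-injectiveʳ; ++-assoc; ++-identityʳ; length-++; length-map;
         length-upTo; map-∘; ++-conicalˡ; take++drop≡id; map-cong; map-applyUpTo; filter-++)
open import Data.Maybe using (Maybe; just; nothing; is-just; _<∣>_; to-witness-T)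
import Data.Maybe as Maybe
open import Data.Nat
  using (ℕ; zero; suc; _+_; _*_; _^_; _⊔_; _≤_; _<_; s≤s; z≤n; _≤′_; ≤′-refl; ≤′-step)
import Data.Nat as ℕ
open import Data.Nat.Properties hiding (_≟_)
open import Data.Nat.Tactic.RingSolver using (solve-∀)
open import Data.Product using (Σ; ∃; _×_; _,_; proj₁; proj₂)
open import Data.Sum using (_⊎_; inj₁; inj₂; [_,_]′)
open import Data.Unit using (⊤; tt)
import Data.Vec as Vec
open import Function using (_∘_; id; Equivalence)
open import Relation.Binary.PropositionalEquality
open import Relation.Nullary using (¬_; Dec; yes; no)
open import Relation.Nullary.Decidable using (_×-dec_; _⊎-dec_; _→-dec_; dec⇒maybe)

factor-suc : ∀ z i n → factor z i (suc n) ≡ z i ∷ factor z (suc i) n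
factor-suc z i n = cong₂ _∷_ (cong z (+-identityʳ i)) (begin
  map f (applyUpTo suc n)    ≡⟨ cong (map f) (sym (map-applyUpTo id suc n)) ⟩
  map f (map suc (upTo n))   ≡⟨ sym (map-∘ (upTo n)) ⟩
  map (f ∘ suc) (upTo n)     ≡⟨ map-cong (λ j → cong z (+-suc i j)) (upTo n) ⟩
  factor z (suc i) n         ∎)
  where
  open ≡-Reasoning
  f : ℕ → Letter
  f j = z (i + j)

length-factor : ∀ z i n → length (factor z i n) ≡ n
length-factor z i n = trans (length-map (λ j → z (i + j)) (upTo n)) (length-upTo n)

-- The factor of length n at i, unfolded letter by letter (z i ∷ z (1+i) ∷ …), so that
-- statements about short windows reduce to statements about individual letters.
window : InfWord → ℕ → ℕ → FinWord
window z i zero    = []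
window z i (suc n) = z i ∷ window z (suc i) n

factor-window : ∀ z i n → factor z i n ≡ window z i n
factor-window z i zero    = refl
factor-window z i (suc n) = trans (factor-suc z i n) (cong (z i ∷_) (factor-window z (suc i) n))

factor-+ : ∀ z i m n → factor z i (m + n) ≡ factor z i m ++ factor z (i + m) n
factor-+ z i zero    n = cong (λ j → factor z j n) (sym (+-identityʳ i))
factor-+ z i (suc m) n = begin
  factor z i (suc (m + n))                                ≡⟨ factor-suc z i (m + n) ⟩
  z i ∷ factor z (suc i) (m + n)                          ≡⟨ cong (z i ∷_) (factor-+ z (suc i) m n) ⟩
  z i ∷ factor z (suc i) m ++ factor z (suc i + m) n      ≡⟨ cong₂ _++_ (sym (factor-suc z i m))
                                                              (cong (λ j → factor z j n) (sym (+-suc i m))) ⟩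
  factor z i (suc m) ++ factor z (i + suc m) n            ∎
  where open ≡-Reasoning

factor-prefix : ∀ z i n u v → factor z i n ≡ u ++ v → factor z i (length u) ≡ u
factor-prefix z i n       []      v e = refl
factor-prefix z i zero    (b ∷ u) v ()
factor-prefix z i (suc n) (b ∷ u) v e with ∷-injective (trans (sym (factor-suc z i n)) e)
... | refl , e′ = trans (factor-suc z i (length u)) (cong (z i ∷_) (factor-prefix z (suc i) n u v e′))

factor-infix : ∀ z i n u o v → factor z i n ≡ u ++ o ++ v → factor z (i + length u) (length o) ≡ o
factor-infix z i n       []      o v e = trans (cong (λ j → factor z j (length o)) (+-identityʳ i))
                                               (factor-prefix z i n o v e)
factor-infix z i zero    (b ∷ u) o v ()
factor-infix z i (suc n) (b ∷ u) o v e =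
  trans (cong (λ j → factor z j (length o)) (+-suc i (length u)))
        (factor-infix z (suc i) n u o v (∷-injectiveʳ (trans (sym (factor-suc z i n)) e)))

-- Letter counts.  An Abelian equivalence preserves length, since length = #1 + #0.

count-++ : ∀ a u v → count a (u ++ v) ≡ count a u + count a v
count-++ a u v = trans (cong length (filter-++ (a ≟_) u v)) (length-++ (filter (a ≟_) u))

count-head : ∀ a w → count a (a ∷ w) ≡ suc (count a w)
count-head true  w = refl
count-head false w = refl

count-complement : ∀ a x → count a (x ∷ []) + count a (not x ∷ []) ≡ 1
count-complement true  true  = refl
count-complement true  false = refl
count-complement false true  = refl
count-complement false false = refl

count-pair : ∀ a x → count a (x ∷ not x ∷ []) ≡ 1
count-pair a x = trans (count-++ a (x ∷ []) (not x ∷ [])) (count-complement a x)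

count-letters : ∀ u → count true u + count false u ≡ length u
count-letters []          = refl
count-letters (true ∷ u)  = cong suc (count-letters u)
count-letters (false ∷ u) = trans (+-suc (count true u) (count false u)) (cong suc (count-letters u))

abelian-length : ∀ u v → AbelianEquiv u v → length u ≡ length v
abelian-length u v e =
  trans (sym (count-letters u)) (trans (cong₂ _+_ (e true) (e false)) (count-letters v))

equiv-[] : ∀ v → AbelianEquiv [] v → v ≡ []
equiv-[] []      _ = refl
equiv-[] (x ∷ v) e with abelian-length [] (x ∷ v) e
... | ()

abelianEquiv? : ∀ u v → Dec (AbelianEquiv u v)
abelianEquiv? u v with count true u ℕ.≟ count true v | count false u ℕ.≟ count false v
... | yes e₁ | yes e₀ = yes λ { true → e₁ ; false → e₀ }
... | no ¬e₁ | _      = no λ e → ¬e₁ (e true)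
... | _      | no ¬e₀ = no λ e → ¬e₀ (e false)

-- Each search returns a witness (so its answers are correct by
-- construction); the facts about short windows below are then established by running a search
-- on every binary word of the given length and checking that it never fails.

firstJust : ∀ {A : Set} → List (Maybe A) → Maybe A
firstJust = foldr _<∣>_ nothing

prefixOf? : (o w : FinWord) → Maybe (∃ λ v → w ≡ o ++ v)
prefixOf? []      w       = just (w , refl)
prefixOf? (b ∷ o) []      = nothing
prefixOf? (b ∷ o) (c ∷ w) with c ≟ b
... | yes refl = Maybe.map (λ (v , e) → v , cong (b ∷_) e) (prefixOf? o w)
... | no _     = nothing

Occurs : FinWord → FinWord → Set
Occurs o w = Σ FinWord λ u → Σ FinWord λ v → w ≡ u ++ o ++ v

occurs? : (o w : FinWord) → Maybe (Occurs o w)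
occurs? o []      = Maybe.map (λ (v , e) → [] , v , e) (prefixOf? o [])
occurs? o (b ∷ w) = Maybe.map (λ (v , e) → [] , v , e) (prefixOf? o (b ∷ w))
                <∣> Maybe.map (λ (u , v , e) → b ∷ u , v , cong (b ∷_) e) (occurs? o w)

overlapWord : Letter → FinWord → FinWord
overlapWord a x = (a ∷ x) ++ (a ∷ x) ++ (a ∷ [])

overlapWord-length : ∀ a x → length (overlapWord a x) ≡ 3 + 2 * length x
overlapWord-length a x = begin
  length (overlapWord a x)                 ≡⟨ length-++ (a ∷ x) ⟩
  suc ℓ + length ((a ∷ x) ++ a ∷ [])       ≡⟨ cong (suc ℓ +_) (length-++ (a ∷ x)) ⟩
  suc ℓ + (suc ℓ + 1)                      ≡⟨ solve ℓ ⟩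
  3 + 2 * ℓ                                ∎
  where
  open ≡-Reasoning
  ℓ = length x
  solve : ∀ ℓ → suc ℓ + (suc ℓ + 1) ≡ 3 + 2 * ℓ
  solve = solve-∀

HasOverlap : FinWord → Set
HasOverlap w = Σ Letter λ a → Σ FinWord λ x → Occurs (overlapWord a x) w

-- Any overlap a x a x a in w has x a factor of w, so it suffices to try those.
findOverlap : (w : FinWord) → Maybe (HasOverlap w)
findOverlap w = firstJust (concatMap try (concatMap inits (tails w)))
  where
  try : FinWord → List (Maybe (HasOverlap w))
  try x = map (λ a → Maybe.map (λ occ → a , x , occ) (occurs? (overlapWord a x) w)) (false ∷ true ∷ [])

HasRepeat : FinWord → Set
HasRepeat w = Σ Letter λ a → Occurs (a ∷ a ∷ []) w

findRepeat : (w : FinWord) → Maybe (HasRepeat w)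
findRepeat w = firstJust (map (λ a → Maybe.map (a ,_) (occurs? (a ∷ a ∷ []) w)) (false ∷ true ∷ []))

abelianSquare : ∀ u v → u ≢ [] → AbelianEquiv u v → AbelianPower 2 (u ++ v)
abelianSquare u v u≢[] e = (λ uv≡[] → u≢[] (++-conicalˡ u v uv≡[])) ,
  halves , cong (u ++_) (++-identityʳ v) , pairs
  where
  halves = u Vec.∷ v Vec.∷ Vec.[]
  pairs : ∀ i j → AbelianEquiv (Vec.lookup halves i) (Vec.lookup halves j)
  pairs #0      #0      a = refl
  pairs #0      (#s #0) a = e a
  pairs (#s #0) #0      a = sym (e a)
  pairs (#s #0) (#s #0) a = refl

squarePrefix? : (w : FinWord) → Maybe (HasAbelianPowerPrefix 2 w)
squarePrefix? w = firstJust (map try (inits w))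
  where
  fromSplit : ∀ u → u ≢ [] → (∃ λ r → w ≡ u ++ r) → Maybe (HasAbelianPowerPrefix 2 w)
  fromSplit u u≢[] (r , w≡ur) with abelianEquiv? u (take (length u) r)
  ... | no _   = nothing
  ... | yes ae = just (u ++ v , s , trans w≡ur w≡uvs , abelianSquare u v u≢[] ae)
    where
    v = take (length u) r
    s = drop (length u) r
    w≡uvs : u ++ r ≡ (u ++ v) ++ s
    w≡uvs = trans (cong (u ++_) (sym (take++drop≡id (length u) r))) (sym (++-assoc u v s))
  try : FinWord → Maybe (HasAbelianPowerPrefix 2 w)
  try []      = nothing
  try (b ∷ u) = Maybe.maybe (fromSplit (b ∷ u) (λ ())) nothing (prefixOf? (b ∷ u) w)

everyWord : ℕ → (FinWord → Bool) → Bool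
everyWord zero    p = p []
everyWord (suc n) p = everyWord n (p ∘ (false ∷_)) ∧ everyWord n (p ∘ (true ∷_))

everyWord-sound : ∀ n p → T (everyWord n p) → ∀ w → length w ≡ n → T (p w)
everyWord-sound zero    p ok []          refl = ok
everyWord-sound (suc n) p ok (false ∷ w) refl =
  everyWord-sound n (p ∘ (false ∷_)) (proj₁ (Equivalence.to T-∧ ok)) w refl
everyWord-sound (suc n) p ok (true ∷ w)  refl =
  everyWord-sound n (p ∘ (true ∷_)) (proj₂ (Equivalence.to T-∧ ok)) w refl

byExhaustion : ∀ {P : FinWord → Set} n (search : ∀ w → Maybe (P w)) →
               T (everyWord n (is-just ∘ search)) → ∀ w → length w ≡ n → P w
byExhaustion n search ok w |w|≡n =
  to-witness-T (search w) (everyWord-sound n (is-just ∘ search) ok w |w|≡n)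

-- Every binary word of length 5 contains aa or an overlap (the alternating words are overlaps).
repeatOrOverlap : ∀ w → length w ≡ 5 → HasRepeat w ⊎ HasOverlap w
repeatOrOverlap =
  byExhaustion 5 (λ w → Maybe.map inj₁ (findRepeat w) <∣> Maybe.map inj₂ (findOverlap w)) tt

squareOrOverlap : ∀ w → length w ≡ 10 → HasAbelianPowerPrefix 2 w ⊎ HasOverlap w
squareOrOverlap =
  byExhaustion 10 (λ w → Maybe.map inj₁ (squarePrefix? w) <∣> Maybe.map inj₂ (findOverlap w)) tt

-- In a 7-letter window x₀ … x₆ with x₁ = x₂, the pairs x₂x₃ and x₄x₅ are distinct letters and the
-- next repeated letter is x₃x₄ or x₅x₆ (x₀ is needed to exclude the overlaps that would follow).
SquareSpacing : FinWord → Set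
SquareSpacing (x₀ ∷ x₁ ∷ x₂ ∷ x₃ ∷ x₄ ∷ x₅ ∷ x₆ ∷ []) =
  x₂ ≡ x₁ → x₃ ≡ not x₂ × x₅ ≡ not x₄ × (x₄ ≡ x₃ ⊎ x₆ ≡ x₅)
SquareSpacing _ = ⊤

-- Only windows of length 7 are ever queried.
squareSpacing? : ∀ w → Maybe (SquareSpacing w)
squareSpacing? (x₀ ∷ x₁ ∷ x₂ ∷ x₃ ∷ x₄ ∷ x₅ ∷ x₆ ∷ []) =
  dec⇒maybe ((x₂ ≟ x₁) →-dec (x₃ ≟ not x₂) ×-dec (x₅ ≟ not x₄) ×-dec ((x₄ ≟ x₃) ⊎-dec (x₆ ≟ x₅)))
squareSpacing? _ = nothing

spacingOrOverlap : ∀ w → length w ≡ 7 → SquareSpacing w ⊎ HasOverlap w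
spacingOrOverlap =
  byExhaustion 7 (λ w → Maybe.map inj₁ (squareSpacing? w) <∣> Maybe.map inj₂ (findOverlap w)) tt

-- Local structure of overlap-free words.

noOverlapIn : ∀ z → OverlapFree z → ∀ i n → ¬ HasOverlap (factor z i n)
noOverlapIn z noOverlap i n (a , x , u , v , e) =
  noOverlap (i + length u) a x
    (subst (λ ℓ → factor z (i + length u) ℓ ≡ overlapWord a x) (overlapWord-length a x)
      (factor-infix z i n u (overlapWord a x) v e))

Repeat Flip : InfWord → ℕ → Set
Repeat z i = z (suc i) ≡ z i
Flip   z i = z (suc i) ≡ not (z i)

someRepeat : ∀ z → OverlapFree z → Σ ℕ λ h → Repeat z (suc h)
someRepeat z noOverlap with repeatOrOverlap (factor z 1 5) (length-factor z 1 5)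
... | inj₂ ov = ⊥-elim (noOverlapIn z noOverlap 1 5 ov)
... | inj₁ (a , u , v , e) with ∷-injective (trans (sym (factor-window z (suc (length u)) 2))
                                                    (factor-infix z 1 5 u (a ∷ a ∷ []) v e))
...   | first , rest = length u , trans (∷-injectiveˡ rest) (sym first)

repeatSpacing : ∀ z → OverlapFree z → ∀ h → Repeat z (suc h) →
          Flip z (2 + h) × Flip z (4 + h) × (Repeat z (3 + h) ⊎ Repeat z (5 + h))
repeatSpacing z noOverlap h with spacingOrOverlap (factor z h 7) (length-factor z h 7)
... | inj₁ sp = subst SquareSpacing (factor-window z h 7) sp
... | inj₂ ov = ⊥-elim (noOverlapIn z noOverlap h 7 ov)

skip : ℕ → ℕ → ℕ
skip zero    p = p
skip (suc d) p = skip d (suc (suc p))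

flipsAfterRepeat : ∀ z → OverlapFree z → ∀ h → Repeat z (suc h) → ∀ d → Flip z (skip d (2 + h))
flipsAfterRepeat z noOverlap h r zero          = proj₁ (repeatSpacing z noOverlap h r)
flipsAfterRepeat z noOverlap h r (suc zero)    = proj₁ (proj₂ (repeatSpacing z noOverlap h r))
flipsAfterRepeat z noOverlap h r (suc (suc d)) =
  [ (λ r₃ → flipsAfterRepeat z noOverlap (2 + h) r₃ (suc d))
  , (λ r₅ → flipsAfterRepeat z noOverlap (4 + h) r₅ d)
  ]′ (proj₂ (proj₂ (repeatSpacing z noOverlap h r)))

everywhereSquares : ∀ z → OverlapFree z → EverywhereAbelianRepetitive 2 z
everywhereSquares z noOverlap = 10 , s≤s z≤n , λ i →
  [ id , (λ ov → ⊥-elim (noOverlapIn z noOverlap i 10 ov)) ]′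
    (squareOrOverlap (factor z i 10) (length-factor z i 10))

-- The Thue–Morse morphism on infinite words: μ∞ y = μ(y 0) μ(y 1) μ(y 2) ⋯.
μ∞ : InfWord → InfWord
μ∞ y zero          = y zero
μ∞ y (suc zero)    = not (y zero)
μ∞ y (suc (suc n)) = μ∞ (λ m → y (suc m)) n

double-suc : ∀ m → suc m + suc m ≡ suc (suc (m + m))
double-suc m = cong suc (+-suc m m)

μ∞-even : ∀ y m → μ∞ y (m + m) ≡ y m
μ∞-even y zero    = refl
μ∞-even y (suc m) = trans (cong (μ∞ y) (double-suc m)) (μ∞-even (λ n → y (suc n)) m)

μ∞-odd : ∀ y m → μ∞ y (suc (m + m)) ≡ not (y m)
μ∞-odd y zero    = refl
μ∞-odd y (suc m) = trans (cong (μ∞ y ∘ suc) (double-suc m)) (μ∞-odd (λ n → y (suc n)) m)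

parity : ∀ n → ∃ λ m → n ≡ m + m ⊎ n ≡ suc (m + m)
parity zero    = 0 , inj₁ refl
parity (suc n) with parity n
... | m , inj₁ n≡2m  = m , inj₂ (cong suc n≡2m)
... | m , inj₂ n≡2m+1 = suc m , inj₁ (trans (cong suc n≡2m+1) (sym (double-suc m)))

positive-parity : ∀ {m} → 1 ≤ m → ∃ λ t → m ≡ suc (t + t) ⊎ m ≡ suc (suc (t + t))
positive-parity {m} 1≤m with parity m
... | zero  , inj₁ refl = ⊥-elim (<-irrefl refl 1≤m)
... | suc t , inj₁ refl = t , inj₂ (double-suc t)
... | t     , inj₂ refl = t , inj₁ refl

μ∞-unique : ∀ (w y : InfWord) → (∀ m → w (m + m) ≡ y m) → (∀ m → w (suc (m + m)) ≡ not (y m)) →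
            ∀ n → w n ≡ μ∞ y n
μ∞-unique w y even odd n with parity n
... | m , inj₁ refl = trans (even m) (sym (μ∞-even y m))
... | m , inj₂ refl = trans (odd m) (sym (μ∞-odd y m))

μ₁-pair : ∀ a → μ₁ a ≡ a ∷ not a ∷ []
μ₁-pair true  = refl
μ₁-pair false = refl

μ-++ : ∀ u v → μ (u ++ v) ≡ μ u ++ μ v
μ-++ []      v = refl
μ-++ (a ∷ u) v = trans (cong (μ₁ a ++_) (μ-++ u v)) (sym (++-assoc (μ₁ a) (μ u) (μ v)))

μ∞-factor : ∀ y i n → factor (μ∞ y) (i + i) (n + n) ≡ μ (factor y i n)
μ∞-factor y i zero    = refl
μ∞-factor y i (suc n) = begin
  factor (μ∞ y) (i + i) (suc n + suc n)
    ≡⟨ cong (factor (μ∞ y) (i + i)) (double-suc n) ⟩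
  factor (μ∞ y) (i + i) (suc (suc (n + n)))
    ≡⟨ trans (factor-suc (μ∞ y) (i + i) _) (cong (μ∞ y (i + i) ∷_) (factor-suc (μ∞ y) (suc (i + i)) _)) ⟩
  μ∞ y (i + i) ∷ μ∞ y (suc (i + i)) ∷ factor (μ∞ y) (suc (suc (i + i))) (n + n)
    ≡⟨ cong₂ _∷_ (μ∞-even y i) (cong₂ _∷_ (μ∞-odd y i) rest) ⟩
  y i ∷ not (y i) ∷ μ (factor y (suc i) n)
    ≡⟨ cong (_++ μ (factor y (suc i) n)) (sym (μ₁-pair (y i))) ⟩
  μ (y i ∷ factor y (suc i) n)
    ≡⟨ cong μ (sym (factor-suc y i n)) ⟩
  μ (factor y i (suc n))
    ∎
  where
  open ≡-Reasoning
  rest : factor (μ∞ y) (suc (suc (i + i))) (n + n) ≡ μ (factor y (suc i) n)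
  rest = trans (cong (λ j → factor (μ∞ y) j (n + n)) (sym (double-suc i))) (μ∞-factor y (suc i) n)

ImageFrom : InfWord → ℕ → InfWord → Set
ImageFrom z p y = ∀ n → z (p + n) ≡ μ∞ y n

image-factor : ∀ z p y → ImageFrom z p y → ∀ i n → factor z (p + i) n ≡ factor (μ∞ y) i n
image-factor z p y image i n =
  map-cong (λ j → trans (cong z (+-assoc p i j)) (image (i + j))) (upTo n)

-- μ(a x a x a) = a X a X a ā with X = ā μ(x): the image of an overlap contains an overlap.
μ-overlap : ∀ a x → μ (overlapWord a x) ≡ overlapWord a (not a ∷ μ x) ++ not a ∷ []
μ-overlap a x = begin
  μ (overlapWord a x)                               ≡⟨ μ-++ (a ∷ x) _ ⟩
  μ (a ∷ x) ++ μ ((a ∷ x) ++ a ∷ [])                ≡⟨ cong (μ (a ∷ x) ++_) (μ-++ (a ∷ x) (a ∷ [])) ⟩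
  μ (a ∷ x) ++ μ (a ∷ x) ++ μ₁ a ++ []
    ≡⟨ cong (λ p → (p ++ μ x) ++ (p ++ μ x) ++ p ++ []) (μ₁-pair a) ⟩
  X ++ X ++ a ∷ not a ∷ []                          ≡⟨ cong (X ++_) (sym (++-assoc X (a ∷ []) (not a ∷ []))) ⟩
  X ++ (X ++ a ∷ []) ++ not a ∷ []                  ≡⟨ sym (++-assoc X (X ++ a ∷ []) (not a ∷ [])) ⟩
  overlapWord a (not a ∷ μ x) ++ not a ∷ []         ∎
  where
  open ≡-Reasoning
  X = a ∷ not a ∷ μ x

overlapFree-preimage : ∀ z p y → OverlapFree z → ImageFrom z p y → OverlapFree y
overlapFree-preimage z p y noOverlap image i a x y-overlap =
  noOverlapIn z noOverlap (p + (i + i)) (ℓ + ℓ) (a , not a ∷ μ x , [] , not a ∷ [] , image-overlap)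
  where
  ℓ = 3 + 2 * length x
  image-overlap : factor z (p + (i + i)) (ℓ + ℓ) ≡ overlapWord a (not a ∷ μ x) ++ not a ∷ []
  image-overlap = begin
    factor z (p + (i + i)) (ℓ + ℓ)   ≡⟨ image-factor z p y image (i + i) (ℓ + ℓ) ⟩
    factor (μ∞ y) (i + i) (ℓ + ℓ)    ≡⟨ μ∞-factor y i ℓ ⟩
    μ (factor y i ℓ)                 ≡⟨ cong μ y-overlap ⟩
    μ (overlapWord a x)              ≡⟨ μ-overlap a x ⟩
    overlapWord a (not a ∷ μ x) ++ not a ∷ []  ∎
    where open ≡-Reasoning

image-of-flips : ∀ z p → (∀ d → Flip z (skip d p)) → ImageFrom z p (λ m → z (skip m p))
image-of-flips z p flips zero          = cong z (+-identityʳ p)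
image-of-flips z p flips (suc zero)    = trans (cong z (+-comm p 1)) (flips 0)
image-of-flips z p flips (suc (suc n)) =
  trans (cong z (trans (+-suc p (suc n)) (cong suc (+-suc p n))))
        (image-of-flips z (suc (suc p)) (flips ∘ suc) n)

desubstitute : ∀ z → OverlapFree z → Σ ℕ λ p → Σ InfWord λ y → OverlapFree y × ImageFrom z (suc p) y
desubstitute z noOverlap with someRepeat z noOverlap
... | h , r = suc h , _ , overlapFree-preimage z (2 + h) _ noOverlap image , image
  where
  image = image-of-flips z (2 + h) (flipsAfterRepeat z noOverlap h r)

-- The Thue–Morse word.  TM₀ is defined through the finite iterates μᵏ(0); we show
-- TM₀ (2m) = TM₀ m and TM₀ (2m+1) = not (TM₀ m), i.e. that TM₀ is the fixed point of μ∞.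

-- Lookup with a default letter, which avoids carrying bound proofs around.
at : FinWord → ℕ → Letter
at []      n       = false
at (x ∷ w) zero    = x
at (x ∷ w) (suc n) = at w n

lookup-at : ∀ w i (i<|w| : i < length w) → lookup w (fromℕ< i<|w|) ≡ at w i
lookup-at (x ∷ w) zero    _           = refl
lookup-at (x ∷ w) (suc i) (s≤s i<|w|) = lookup-at w i i<|w|

at-++ˡ : ∀ u v {i} → i < length u → at (u ++ v) i ≡ at u i
at-++ˡ (x ∷ u) v {zero}  _           = refl
at-++ˡ (x ∷ u) v {suc i} (s≤s i<|u|) = at-++ˡ u v i<|u|

μ-cons : ∀ a w → μ (a ∷ w) ≡ a ∷ not a ∷ μ w
μ-cons a w = cong (_++ μ w) (μ₁-pair a)

μ-length : ∀ w → length (μ w) ≡ length w + length w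
μ-length []      = refl
μ-length (a ∷ w) = trans (cong length (μ-cons a w))
                         (trans (cong (suc ∘ suc) (μ-length w)) (sym (double-suc (length w))))

at-μ-even : ∀ w q → at (μ w) (q + q) ≡ at w q
at-μ-even []      q       = refl
at-μ-even (a ∷ w) zero    = cong (λ v → at v 0) (μ-cons a w)
at-μ-even (a ∷ w) (suc q) =
  trans (cong₂ at (μ-cons a w) (double-suc q)) (at-μ-even w q)

at-μ-odd : ∀ w q → q < length w → at (μ w) (suc (q + q)) ≡ not (at w q)
at-μ-odd (a ∷ w) zero    _           = cong (λ v → at v 1) (μ-cons a w)
at-μ-odd (a ∷ w) (suc q) (s≤s q<|w|) =
  trans (cong₂ at (μ-cons a w) (cong suc (double-suc q))) (at-μ-odd w q q<|w|)

iterate-step : ∀ k → ∃ λ r → μIter (suc k) ≡ μIter k ++ r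
iterate-step zero    = true ∷ [] , refl
iterate-step (suc k) with iterate-step k
... | r , e = μ r , trans (cong μ e) (μ-++ (μIter k) r)

iterate-prefix : ∀ {k m} → k ≤′ m → ∃ λ r → μIter m ≡ μIter k ++ r
iterate-prefix {k} ≤′-refl = [] , sym (++-identityʳ (μIter k))
iterate-prefix {k} {suc m} (≤′-step k≤m) with iterate-prefix k≤m | iterate-step m
... | r , e | r′ , e′ = r ++ r′ , trans e′ (trans (cong (_++ r′) e) (++-assoc (μIter k) r r′))

at-iterate : ∀ {k m i} → k ≤ m → i < length (μIter k) → at (μIter m) i ≡ at (μIter k) i
at-iterate {k} {i = i} k≤m i<|μᵏ| with iterate-prefix (≤⇒≤′ k≤m)
... | r , e = trans (cong (λ w → at w i) e) (at-++ˡ (μIter k) r i<|μᵏ|)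

TM-at : ∀ k i → i < length (μIter k) → TM₀ i ≡ at (μIter k) i
TM-at k i i<|μᵏ| = begin
  TM₀ i                     ≡⟨ lookup-at (μIter (suc i)) i (μIter-len i) ⟩
  at (μIter (suc i)) i      ≡⟨ sym (at-iterate (m≤n⊔m k (suc i)) (μIter-len i)) ⟩
  at (μIter (k ⊔ suc i)) i  ≡⟨ at-iterate (m≤m⊔n k (suc i)) i<|μᵏ| ⟩
  at (μIter k) i            ∎
  where open ≡-Reasoning

TM-even : ∀ m → TM₀ (m + m) ≡ TM₀ m
TM-even m = begin
  TM₀ (m + m)                     ≡⟨ TM-at (2 + m) (m + m) bound ⟩
  at (μ (μIter (suc m))) (m + m)  ≡⟨ at-μ-even (μIter (suc m)) m ⟩
  at (μIter (suc m)) m            ≡⟨ sym (TM-at (suc m) m (μIter-len m)) ⟩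
  TM₀ m                           ∎
  where
  open ≡-Reasoning
  bound : m + m < length (μIter (2 + m))
  bound = subst (m + m <_) (sym (μ-length (μIter (suc m)))) (+-mono-< (μIter-len m) (μIter-len m))

TM-odd : ∀ m → TM₀ (suc (m + m)) ≡ not (TM₀ m)
TM-odd m = begin
  TM₀ (suc (m + m))                     ≡⟨ TM-at (2 + m) (suc (m + m)) bound ⟩
  at (μ (μIter (suc m))) (suc (m + m))  ≡⟨ at-μ-odd (μIter (suc m)) m (μIter-len m) ⟩
  not (at (μIter (suc m)) m)            ≡⟨ cong not (sym (TM-at (suc m) m (μIter-len m))) ⟩
  not (TM₀ m)                           ∎
  where
  open ≡-Reasoning
  bound : suc (m + m) < length (μIter (2 + m))
  bound = subst (suc (m + m) <_) (sym (μ-length (μIter (suc m))))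
            (≤-trans (≤-reflexive (sym (double-suc m))) (+-mono-≤ (μIter-len m) (μIter-len m)))

TM-fixed : ImageFrom TM₀ 0 TM₀
TM-fixed = μ∞-unique TM₀ TM₀ TM-even TM-odd

TM-pair : ∀ t → TM₀ (suc (t + t)) ≡ not (TM₀ (t + t))
TM-pair t = trans (TM-odd t) (cong not (sym (TM-even t)))

TM-quad : ∀ t → TM₀ (suc (t + t) + suc (t + t)) ≡ not (TM₀ (t + t))
TM-quad t = trans (TM-even (suc (t + t))) (TM-pair t)

-- Thue–Morse blocks.  Block z i b k: the factor of length 2ᵏ at position i is μᵏ(b),
-- i.e. a prefix of TM₀ or of its complement.
Block : InfWord → ℕ → Letter → ℕ → Set
Block z i b k = ∀ t → t < 2 ^ k → z (i + t) ≡ b xor TM₀ t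

block-zero : ∀ z i → Block z i (z i) 0
block-zero z i zero    _        = trans (cong z (+-identityʳ i)) (sym (xor-identityʳ (z i)))
block-zero z i (suc t) (s≤s ())

half-< : ∀ s N → s + s < N + N → s < N
half-< s N 2s<2N = ≰⇒> λ N≤s → <⇒≱ 2s<2N (+-mono-≤ N≤s N≤s)

2^suc : ∀ k → 2 ^ suc k ≡ 2 ^ k + 2 ^ k
2^suc k = cong (2 ^ k +_) (+-identityʳ (2 ^ k))

block-image : ∀ z p y {i b k} → ImageFrom z p y → Block y i b k → Block z (p + (i + i)) b (suc k)
block-image z p y {i} {b} {k} image block t t<2ᵏ⁺¹ with parity t
... | s , inj₁ refl = begin
  z (p + (i + i) + (s + s))    ≡⟨ cong z (+-assoc p (i + i) (s + s)) ⟩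
  z (p + ((i + i) + (s + s)))  ≡⟨ image _ ⟩
  μ∞ y ((i + i) + (s + s))     ≡⟨ cong (μ∞ y) (interleave i s) ⟩
  μ∞ y ((i + s) + (i + s))     ≡⟨ μ∞-even y (i + s) ⟩
  y (i + s)                    ≡⟨ block s (half-< s (2 ^ k) (subst (s + s <_) (2^suc k) t<2ᵏ⁺¹)) ⟩
  b xor TM₀ s                  ≡⟨ cong (b xor_) (sym (TM-even s)) ⟩
  b xor TM₀ (s + s)            ∎
  where
  open ≡-Reasoning
  interleave : ∀ i s → (i + i) + (s + s) ≡ (i + s) + (i + s)
  interleave = solve-∀
... | s , inj₂ refl = begin
  z (p + (i + i) + suc (s + s))    ≡⟨ cong z (+-assoc p (i + i) (suc (s + s))) ⟩
  z (p + ((i + i) + suc (s + s)))  ≡⟨ image _ ⟩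
  μ∞ y ((i + i) + suc (s + s))     ≡⟨ cong (μ∞ y) (interleave i s) ⟩
  μ∞ y (suc ((i + s) + (i + s)))   ≡⟨ μ∞-odd y (i + s) ⟩
  not (y (i + s))                  ≡⟨ cong not (block s (half-< s (2 ^ k) (<-trans (n<1+n (s + s))
                                                    (subst (suc (s + s) <_) (2^suc k) t<2ᵏ⁺¹)))) ⟩
  not (b xor TM₀ s)                ≡⟨ not-distribʳ-xor b (TM₀ s) ⟩
  b xor not (TM₀ s)                ≡⟨ cong (b xor_) (sym (TM-odd s)) ⟩
  b xor TM₀ (suc (s + s))          ∎
  where
  open ≡-Reasoning
  interleave : ∀ i s → (i + i) + suc (s + s) ≡ suc ((i + s) + (i + s))
  interleave = solve-∀

HasBlocks : InfWord → Set
HasBlocks z = ∀ k → Σ ℕ λ h → Σ Letter λ b → Block z (suc h) b k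

blocks-image : ∀ z p y {k} → ImageFrom z p y →
               (Σ ℕ λ h → Σ Letter λ b → Block y (suc h) b k) →
               (Σ ℕ λ h → Σ Letter λ b → Block z (suc h) b (suc k))
blocks-image z p y {k} image (h , b , block) =
  p + (h + suc h) , b ,
  subst (λ i → Block z i b (suc k)) (+-suc p (h + suc h)) (block-image z p y {suc h} {b} {k} image block)

TM-blocks : HasBlocks TM₀
TM-blocks zero    = 0 , TM₀ 1 , block-zero TM₀ 1
TM-blocks (suc k) = blocks-image TM₀ 0 TM₀ {k} TM-fixed (TM-blocks k)

overlapFree-blocks : ∀ k z → OverlapFree z → Σ ℕ λ h → Σ Letter λ b → Block z (suc h) b k
overlapFree-blocks zero    z noOverlap = 0 , z 1 , block-zero z 1
overlapFree-blocks (suc k) z noOverlap =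
  let p , y , y-noOverlap , image = desubstitute z noOverlap
  in  blocks-image z (suc p) y {k} image (overlapFree-blocks k y y-noOverlap)

-- Abelian cubes.

record AbelianCube (p : FinWord) : Set where
  field
    u₁ u₂ u₃ : FinWord
    split    : p ≡ u₁ ++ u₂ ++ u₃
    nonempty : 1 ≤ length u₁
    equiv₂   : AbelianEquiv u₁ u₂
    equiv₃   : AbelianEquiv u₁ u₃

-- If u₁ were empty, so would be u₂, u₃ and the whole cube.
cube-first-nonempty : ∀ u₁ u₂ u₃ → u₁ ++ u₂ ++ u₃ ≢ [] → AbelianEquiv u₁ u₂ → AbelianEquiv u₁ u₃ →
                      1 ≤ length u₁
cube-first-nonempty (_ ∷ _) _  _  _        _  _  = s≤s z≤n
cube-first-nonempty []      u₂ u₃ cube≢[] e₂ e₃ =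
  ⊥-elim (cube≢[] (cong₂ _++_ (equiv-[] u₂ e₂) (equiv-[] u₃ e₃)))

abelianCube : ∀ {p} → AbelianPower 3 p → AbelianCube p
abelianCube {p} (p≢[] , u₁ Vec.∷ u₂ Vec.∷ u₃ Vec.∷ Vec.[] , concat≡p , equiv) = record
  { u₁ = u₁ ; u₂ = u₂ ; u₃ = u₃ ; split = split
  ; nonempty = cube-first-nonempty u₁ u₂ u₃ (p≢[] ∘ trans split) equiv₂ equiv₃
  ; equiv₂ = equiv₂ ; equiv₃ = equiv₃ }
  where
  split : p ≡ u₁ ++ u₂ ++ u₃
  split = trans (sym concat≡p) (cong (λ w → u₁ ++ u₂ ++ w) (++-identityʳ u₃))
  equiv₂ = equiv #0 (#s #0)
  equiv₃ = equiv #0 (#s (#s #0))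

cubePrefix-counts : ∀ z h n → HasAbelianPowerPrefix 3 (factor z h n) →
  Σ ℕ λ m → 1 ≤ m × m + (m + m) ≤ n × ∀ a → let K = count a (factor z h m) in
    count a (factor z h (m + m)) ≡ K + K × count a (factor z h (m + (m + m))) ≡ K + (K + K)
cubePrefix-counts z h n (p , s , factor≡ps , power) = m , nonempty , bound , λ a → counts₂ a , counts₃ a
  where
  open AbelianCube (abelianCube power)
  m = length u₁
  length₂ : length (u₁ ++ u₂) ≡ m + m
  length₂ = trans (length-++ u₁) (cong (m +_) (sym (abelian-length u₁ u₂ equiv₂)))
  length₃ : length (u₁ ++ u₂ ++ u₃) ≡ m + (m + m)
  length₃ = trans (length-++ u₁) (cong (m +_) (trans (length-++ u₂)
              (cong₂ _+_ (sym (abelian-length u₁ u₂ equiv₂)) (sym (abelian-length u₁ u₃ equiv₃)))))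
  whole : factor z h n ≡ (u₁ ++ u₂ ++ u₃) ++ s
  whole = trans factor≡ps (cong (_++ s) split)
  bound : m + (m + m) ≤ n
  bound = subst₂ _≤_ length₃ whole-length (m≤m+n _ (length s))
    where
    whole-length : length (u₁ ++ u₂ ++ u₃) + length s ≡ n
    whole-length = trans (sym (length-++ (u₁ ++ u₂ ++ u₃)))
                         (trans (cong length (sym whole)) (length-factor z h n))
  prefix₃ : factor z h (length (u₁ ++ u₂ ++ u₃)) ≡ u₁ ++ u₂ ++ u₃
  prefix₃ = factor-prefix z h n _ s whole
  prefix₁ : factor z h m ≡ u₁
  prefix₁ = factor-prefix z h _ u₁ (u₂ ++ u₃) prefix₃
  prefix₂ : factor z h (length (u₁ ++ u₂)) ≡ u₁ ++ u₂
  prefix₂ = factor-prefix z h _ (u₁ ++ u₂) u₃ (trans prefix₃ (sym (++-assoc u₁ u₂ u₃)))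
  module _ (a : Letter) where
    open ≡-Reasoning
    K = count a (factor z h m)
    K₁ : count a u₁ ≡ K
    K₁ = cong (count a) (sym prefix₁)
    K₂ : count a u₂ ≡ K
    K₂ = trans (sym (equiv₂ a)) K₁
    K₃ : count a u₃ ≡ K
    K₃ = trans (sym (equiv₃ a)) K₁
    counts₂ : count a (factor z h (m + m)) ≡ K + K
    counts₂ = begin
      count a (factor z h (m + m))                 ≡⟨ cong (λ r → count a (factor z h r)) (sym length₂) ⟩
      count a (factor z h (length (u₁ ++ u₂)))     ≡⟨ cong (count a) prefix₂ ⟩
      count a (u₁ ++ u₂)                           ≡⟨ count-++ a u₁ u₂ ⟩
      count a u₁ + count a u₂                      ≡⟨ cong₂ _+_ K₁ K₂ ⟩
      K + K                                        ∎
    counts₃ : count a (factor z h (m + (m + m))) ≡ K + (K + K)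
    counts₃ = begin
      count a (factor z h (m + (m + m)))             ≡⟨ cong (λ r → count a (factor z h r)) (sym length₃) ⟩
      count a (factor z h (length (u₁ ++ u₂ ++ u₃))) ≡⟨ cong (count a) prefix₃ ⟩
      count a (u₁ ++ u₂ ++ u₃)                       ≡⟨ count-++ a u₁ (u₂ ++ u₃) ⟩
      count a u₁ + count a (u₂ ++ u₃)                ≡⟨ cong (count a u₁ +_) (count-++ a u₂ u₃) ⟩
      count a u₁ + (count a u₂ + count a u₃)         ≡⟨ cong₂ _+_ K₁ (cong₂ _+_ K₂ K₃) ⟩
      K + (K + K)                                    ∎

-- The heart of the proof: a letter c followed by a Thue–Morse block B of order k has no
-- Abelian-cube prefix of length ≤ 2ᵏ + 1.  Every aligned pair of B contains c exactly once,
-- so the prefixes of c·B of even length 2t+2 contain c exactly t+1 times.  For an odd block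
-- length m = 2t+1 this gives t+1 and 3t+2 occurrences in the prefixes of lengths m and 3m;
-- for m = 2t+2 the prefixes of lengths m and 2m contain 1+t+α and 2+2t+β occurrences, where
-- α, β count c in the complementary letters B(2t), B(4t+2), so α + β = 1.  Neither is
-- compatible with the proportions K, 2K, 3K of an Abelian cube.
module LetterThenBlock (z : InfWord) (h : ℕ) (b : Letter) (k : ℕ) (block : Block z (suc h) b k) where

  c : Letter
  c = z h

  -- occurrences of c among the first r letters of B, resp. of c·B
  E C : ℕ → ℕ
  E r = count c (factor z (suc h) r)
  C r = count c (factor z h r)

  complementary : ∀ {i j} → i < 2 ^ k → j < 2 ^ k → TM₀ i ≡ not (TM₀ j) →
                  z (suc h + i) ≡ not (z (suc h + j))
  complementary {i} {j} i<2ᵏ j<2ᵏ tm = begin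
    z (suc h + i)        ≡⟨ block i i<2ᵏ ⟩
    b xor TM₀ i          ≡⟨ cong (b xor_) tm ⟩
    b xor not (TM₀ j)    ≡⟨ sym (not-distribʳ-xor b (TM₀ j)) ⟩
    not (b xor TM₀ j)    ≡⟨ cong not (sym (block j j<2ᵏ)) ⟩
    not (z (suc h + j))  ∎
    where open ≡-Reasoning

  C-suc : ∀ r → C (suc r) ≡ suc (E r)
  C-suc r = trans (cong (count c) (factor-suc z h r)) (count-head c _)

  E-+ : ∀ r s → E (r + s) ≡ E r + count c (factor z (suc h + r) s)
  E-+ r s = trans (cong (count c) (factor-+ z (suc h) r s)) (count-++ c (factor z (suc h) r) (factor z (suc h + r) s))

  E-even : ∀ t → t + t ≤ 2 ^ k → E (t + t) ≡ t
  E-even zero    _     = refl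
  E-even (suc t) bound = begin
    E (suc t + suc t)                   ≡⟨ cong E (trans (double-suc t) (+-comm 2 (t + t))) ⟩
    E ((t + t) + 2)                     ≡⟨ E-+ (t + t) 2 ⟩
    E (t + t) + count c (factor z q 2)  ≡⟨ cong₂ _+_ (E-even t (<⇒≤ 2t<2ᵏ)) one-in-pair ⟩
    t + 1                               ≡⟨ +-comm t 1 ⟩
    suc t                               ∎
    where
    open ≡-Reasoning
    q = suc h + (t + t)
    2t+1<2ᵏ : suc (t + t) < 2 ^ k
    2t+1<2ᵏ = subst (_≤ 2 ^ k) (double-suc t) bound
    2t<2ᵏ : t + t < 2 ^ k
    2t<2ᵏ = <-trans (n<1+n (t + t)) 2t+1<2ᵏ
    flip : z (suc q) ≡ not (z q)
    flip = trans (cong z (sym (+-suc (suc h) (t + t)))) (complementary 2t+1<2ᵏ 2t<2ᵏ (TM-pair t))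
    one-in-pair : count c (factor z q 2) ≡ 1
    one-in-pair = begin
      count c (factor z q 2)              ≡⟨ cong (count c) (factor-window z q 2) ⟩
      count c (z q ∷ z (suc q) ∷ [])      ≡⟨ cong (λ x → count c (z q ∷ x ∷ [])) flip ⟩
      count c (z q ∷ not (z q) ∷ [])      ≡⟨ count-pair c (z q) ⟩
      1                                   ∎

  -- α t: does the block letter at 2t equal c (0 or 1)?
  α : ℕ → ℕ
  α t = count c (z (suc h + (t + t)) ∷ [])

  E-odd : ∀ t → suc (t + t) ≤ 2 ^ k → E (suc (t + t)) ≡ t + α t
  E-odd t bound = begin
    E (suc (t + t))                                ≡⟨ cong E (+-comm 1 (t + t)) ⟩
    E ((t + t) + 1)                                ≡⟨ E-+ (t + t) 1 ⟩
    E (t + t) + count c (factor z (suc h + (t + t)) 1)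
      ≡⟨ cong₂ _+_ (E-even t (<⇒≤ bound)) (cong (count c) (factor-window z (suc h + (t + t)) 1)) ⟩
    t + α t                                        ∎
    where open ≡-Reasoning

  -- Odd block length m = 2t+1: the prefix of length 3m contains 3t+2 ≠ 3(t+1) letters c.
  odd-block : ∀ t → let m = suc (t + t) in m + (m + m) ≤ suc (2 ^ k) → C (m + (m + m)) ≢ C m + (C m + C m)
  odd-block t bound counts = 1+n≢n (begin
    suc (suc (suc u))                  ≡⟨ solve t ⟩
    suc t + (suc t + suc t)            ≡⟨ cong (λ K → K + (K + K)) (sym Cm) ⟩
    C m + (C m + C m)                  ≡⟨ sym counts ⟩
    C (m + (m + m))                    ≡⟨ C3m ⟩
    suc (suc u)                        ∎)
    where
    open ≡-Reasoning
    m = suc (t + t)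
    u = t + (t + t)
    3m≡ : m + (m + m) ≡ suc (suc u + suc u)
    3m≡ = solve-3m t
      where
      solve-3m : ∀ t → suc (t + t) + (suc (t + t) + suc (t + t)) ≡ suc (suc (t + (t + t)) + suc (t + (t + t)))
      solve-3m = solve-∀
    solve : ∀ t → suc (suc (suc (t + (t + t)))) ≡ suc t + (suc t + suc t)
    solve = solve-∀
    Cm : C m ≡ suc t
    Cm = trans (C-suc (t + t)) (cong suc (E-even t (≤-pred (≤-trans (m≤m+n m (m + m)) bound))))
    C3m : C (m + (m + m)) ≡ suc (suc u)
    C3m = trans (cong C 3m≡) (trans (C-suc _)
            (cong suc (E-even (suc u) (≤-pred (subst (_≤ suc (2 ^ k)) 3m≡ bound)))))

  -- Even block length m = 2t+2: with w = 2t+1, the prefixes of lengths m and 2m contain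
  -- 1+t+α t and 1+w+α w letters c, and α t + α w = 1 since B(2t), B(2w) are complementary.
  even-block : ∀ t → let m = suc (suc (t + t)) in m + (m + m) ≤ suc (2 ^ k) → C (m + m) ≢ C m + C m
  even-block t bound counts = three-α≢1 (α t) (begin
    α t + (α t + α t)   ≡⟨ cong (α t +_) (sym αw≡2αt) ⟩
    α t + α w           ≡⟨ cong (λ x → α t + count c (x ∷ [])) B2w≡ ⟩
    α t + count c (not (z (suc h + (t + t))) ∷ [])  ≡⟨ count-complement c _ ⟩
    1                   ∎)
    where
    open ≡-Reasoning
    m = suc (suc (t + t))
    w = suc (t + t)
    2m≡ : m + m ≡ suc (suc (w + w))
    2m≡ = solve-2m t
      where
      solve-2m : ∀ t → suc (suc (t + t)) + suc (suc (t + t)) ≡ suc (suc (suc (t + t) + suc (t + t)))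
      solve-2m = solve-∀
    2m≤ : suc (suc (w + w)) ≤ suc (2 ^ k)
    2m≤ = subst (_≤ suc (2 ^ k)) 2m≡ (≤-trans (m≤n+m (m + m) m) bound)
    2t<2ᵏ : t + t < 2 ^ k
    2t<2ᵏ = ≤-pred (≤-trans (m≤m+n m (m + m)) bound)
    Cm : C m ≡ suc (t + α t)
    Cm = trans (C-suc w) (cong suc (E-odd t 2t<2ᵏ))
    C2m : C (m + m) ≡ suc (w + α w)
    C2m = trans (cong C 2m≡) (trans (C-suc _) (cong suc (E-odd w (≤-pred 2m≤))))
    B2w≡ : z (suc h + (w + w)) ≡ not (z (suc h + (t + t)))
    B2w≡ = complementary (≤-pred 2m≤) 2t<2ᵏ (TM-quad t)
    αw≡2αt : α w ≡ α t + α t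
    αw≡2αt = +-cancelˡ-≡ (suc (suc (t + t))) _ _ (begin
      suc (suc (t + t)) + α w            ≡⟨⟩
      suc (w + α w)                      ≡⟨ sym C2m ⟩
      C (m + m)                          ≡⟨ counts ⟩
      C m + C m                          ≡⟨ cong (λ K → K + K) Cm ⟩
      suc (t + α t) + suc (t + α t)      ≡⟨ solve t (α t) ⟩
      suc (suc (t + t)) + (α t + α t)    ∎)
      where
      solve : ∀ t a → suc (t + a) + suc (t + a) ≡ suc (suc (t + t)) + (a + a)
      solve = solve-∀
    three-α≢1 : ∀ a → a + (a + a) ≢ 1
    three-α≢1 zero    ()
    three-α≢1 (suc a) e with trans (sym (+-suc a (a + suc a))) (cong ℕ.pred e)
    ... | ()

  noCube : ∀ n → n ≤ suc (2 ^ k) → ¬ HasAbelianPowerPrefix 3 (factor z h n)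
  noCube n n≤ cube with cubePrefix-counts z h n cube
  ... | m , 1≤m , 3m≤n , counts with positive-parity 1≤m
  ...   | t , inj₁ refl = odd-block t (≤-trans 3m≤n n≤) (proj₂ (counts c))
  ...   | t , inj₂ refl = even-block t (≤-trans 3m≤n n≤) (proj₁ (counts c))

n<2^n : ∀ n → n < 2 ^ n
n<2^n zero    = s≤s z≤n
n<2^n (suc n) = subst (suc (suc n) ≤_) (sym (2^suc n))
                  (≤-trans (s≤s (m≤n+m (suc n) n)) (+-mono-≤ (n<2^n n) (n<2^n n)))

-- A block of order n has room for a factor of length n (plus one letter) in front of it.
n≤1+2^n : ∀ n → n ≤ suc (2 ^ n)
n≤1+2^n n = ≤-trans (<⇒≤ (n<2^n n)) (n≤1+n _)

-- A word with Thue–Morse blocks of every order at positive positions is not everywhere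
-- Abelian 3-repetitive: for each length n, the factor of length n just before a block of
-- order n has no Abelian-cube prefix.
notEverywhereCubes : ∀ z → HasBlocks z → ¬ EverywhereAbelianRepetitive 3 z
notEverywhereCubes z blocks (n , _ , cubes) with blocks n
... | h , b , block = LetterThenBlock.noCube z h b n block n (n≤1+2^n n) (cubes h)

-- a·TM₀ is a letter followed by Thue–Morse blocks of every order.
cons-noCube : ∀ a → ¬ InfHasAbelianPowerPrefix 3 (cons a TM₀)
cons-noCube a (m , cube) =
  LetterThenBlock.noCube (cons a TM₀) 0 false m (λ t _ → refl) m (n≤1+2^n m)
    (factor (cons a TM₀) 0 m , [] , sym (++-identityʳ _) , cube)

mainTheorem2 : (¬ EverywhereAbelianRepetitive 3 TM₀)
    × (¬ InfHasAbelianPowerPrefix 3 (cons false TM₀) × ¬ InfHasAbelianPowerPrefix 3 (cons true TM₀))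
    × (∀ (z : InfWord) → OverlapFree z →
         EverywhereAbelianRepetitive 2 z × ¬ EverywhereAbelianRepetitive 3 z)
mainTheorem2 =
    notEverywhereCubes TM₀ TM-blocks
  , (cons-noCube false , cons-noCube true)
  , λ z noOverlap → everywhereSquares z noOverlap
                  , notEverywhereCubes z (λ k → overlapFree-blocks k z noOverlap)
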